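{- Up to isomorphism there are exactly ten 2-qBMGs on the vertex set $\{v_1,v_2,v_3,v_4\}$ whose underlying undirected graph is a cycle $C_4$, namely those with edge sets $\{v_1v_2,v_1v_4,v_2v_1,v_2v_3,v_3v_4,v_4v_3\}$, $\{v_1v_2,v_1v_4,v_2v_3,v_3v_2,v_3v_4,v_4v_3\}$, $\{v_1v_2,v_1v_4,v_3v_2,v_3v_4\}$, $\{v_1v_2,v_1v_4,v_3v_2,v_4v_3\}$, $\{v_1v_2,v_2v_1,v_3v_2,v_3v_4,v_4v_1\}$, $\{v_1v_2,v_1v_4,v_3v_2,v_4v_1,v_4v_3\}$, $\{v_1v_2,v_1v_4,v_2v_3,v_4v_3\}$, $\{v_1v_2,v_1v_4,v_3v_2,v_3v_4,v_4v_3\}$, $\{v_1v_2,v_1v_4,v_2v_1,v_2v_3,v_3v_2,v_3v_4\}$, $\{v_1v_2,v_1v_4,v_3v_2,v_3v_4,v_2v_1,v_2v_3,v_4v_1,v_4v_3\}$ (where $xy$ denotes the directed edge from $x$ to $y$).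
   Context: A two-color quasi best match graph (2-qBMG) is a bipartite directed graph $\overrightarrow{G}$ (vertex set split into two color classes, every edge joining vertices of different colors) without loops and parallel edges, satisfying: (N1) if $u$ and $v$ are two independent (non-adjacent) vertices then there exist no vertices $w,t$ such that $ut, vw, tw$ are edges; (N2) if $uv, vw, wt$ are edges then $ut$ is an edge; (N3) if $u$ and $v$ have a common out-neighbor then either every out-neighbor of $u$ is an out-neighbor of $v$ or every out-neighbor of $v$ is an out-neighbor of $u$. The underlying undirected graph of a digraph has the same vertex set and an undirected edge $\{u,v\}$ whenever $uv$ or $vu$ is a directed edge. Two digraphs on the same vertex set $V$ are isomorphic if some permutation $\varphi$ of $V$ satisfies: $xy$ is an edge of the first iff $\varphi(x)\varphi(y)$ is an edge of the second. -}

module Defs where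

open import Data.Nat using (ℕ)
open import Data.Fin using (Fin; zero; suc; _≟_)
open import Data.Fin.Patterns
open import Data.Fin.Permutation using (Permutation′; _⟨$⟩ʳ_)
open import Data.Bool using (Bool; true; false; _∨_; _∧_)
open import Data.List using (List; []; _∷_)
open import Data.Product using (Σ; _×_; _,_; ∃; ∃-syntax)
open import Data.Sum using (_⊎_)
open import Relation.Nullary using (¬_; does)
open import Relation.Binary.PropositionalEquality using (_≡_; _≢_)

-- A relation cannot
-- represent parallel edges, so "no parallel edges" is built in.
Digraph : ℕ → Set
Digraph n = Fin n → Fin n → Bool

module _ {n : ℕ} (E : Digraph n) where

  Edge : Fin n → Fin n → Set
  Edge x y = E x y ≡ true

  Loopless : Set
  Loopless = ∀ x → E x x ≡ false

  Bipartite : Set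
  Bipartite = Σ (Fin n → Bool) λ c → ∀ x y → Edge x y → c x ≢ c y

  Independent : Fin n → Fin n → Set
  Independent u v = u ≢ v × ¬ Edge u v × ¬ Edge v u

  N1 : Set
  N1 = ∀ u v → Independent u v →
         ¬ (Σ (Fin n) λ w → Σ (Fin n) λ t → Edge u t × Edge v w × Edge t w)

  N2 : Set
  N2 = ∀ u v w t → Edge u v → Edge v w → Edge w t → Edge u t

  N3 : Set
  N3 = ∀ u v → (Σ (Fin n) λ w → Edge u w × Edge v w) →
         (∀ x → Edge u x → Edge v x) ⊎ (∀ x → Edge v x → Edge u x)

  Is2qBMG : Set
  Is2qBMG = Bipartite × Loopless × N1 × N2 × N3

  Underlying : Fin n → Fin n → Bool
  Underlying x y = E x y ∨ E y x

C4 : Fin 4 → Fin 4 → Bool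
C4 0F 1F = true
C4 1F 0F = true
C4 1F 2F = true
C4 2F 1F = true
C4 2F 3F = true
C4 3F 2F = true
C4 3F 0F = true
C4 0F 3F = true
C4 _  _  = false

UnderlyingIsC4 : Digraph 4 → Set
UnderlyingIsC4 E = Σ (Permutation′ 4) λ π →
  ∀ x y → Underlying E (π ⟨$⟩ʳ x) (π ⟨$⟩ʳ y) ≡ C4 x y

Isomorphic : ∀ {n} → Digraph n → Digraph n → Set
Isomorphic {n} E₁ E₂ = Σ (Permutation′ n) λ φ →
  ∀ x y → E₁ x y ≡ E₂ (φ ⟨$⟩ʳ x) (φ ⟨$⟩ʳ y)

fromEdges : ∀ {n} → List (Fin n × Fin n) → Digraph n
fromEdges []             x y = false
fromEdges ((a , b) ∷ es) x y = (does (a ≟ x) ∧ does (b ≟ y)) ∨ fromEdges es x y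

v₁ v₂ v₃ v₄ : Fin 4
v₁ = 0F
v₂ = 1F
v₃ = 2F
v₄ = 3F

G : Fin 10 → Digraph 4
G 0F = fromEdges ((v₁ , v₂) ∷ (v₁ , v₄) ∷ (v₂ , v₁) ∷ (v₂ , v₃) ∷ (v₃ , v₄) ∷ (v₄ , v₃) ∷ [])
G 1F = fromEdges ((v₁ , v₂) ∷ (v₁ , v₄) ∷ (v₂ , v₃) ∷ (v₃ , v₂) ∷ (v₃ , v₄) ∷ (v₄ , v₃) ∷ [])
G 2F = fromEdges ((v₁ , v₂) ∷ (v₁ , v₄) ∷ (v₃ , v₂) ∷ (v₃ , v₄) ∷ [])
G 3F = fromEdges ((v₁ , v₂) ∷ (v₁ , v₄) ∷ (v₃ , v₂) ∷ (v₄ , v₃) ∷ [])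
G 4F = fromEdges ((v₁ , v₂) ∷ (v₂ , v₁) ∷ (v₃ , v₂) ∷ (v₃ , v₄) ∷ (v₄ , v₁) ∷ [])
G 5F = fromEdges ((v₁ , v₂) ∷ (v₁ , v₄) ∷ (v₃ , v₂) ∷ (v₄ , v₁) ∷ (v₄ , v₃) ∷ [])
G 6F = fromEdges ((v₁ , v₂) ∷ (v₁ , v₄) ∷ (v₂ , v₃) ∷ (v₄ , v₃) ∷ [])
G 7F = fromEdges ((v₁ , v₂) ∷ (v₁ , v₄) ∷ (v₃ , v₂) ∷ (v₃ , v₄) ∷ (v₄ , v₃) ∷ [])
G 8F = fromEdges ((v₁ , v₂) ∷ (v₁ , v₄) ∷ (v₂ , v₁) ∷ (v₂ , v₃) ∷ (v₃ , v₂) ∷ (v₃ , v₄) ∷ [])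
G 9F = fromEdges ((v₁ , v₂) ∷ (v₁ , v₄) ∷ (v₃ , v₂) ∷ (v₃ , v₄) ∷ (v₂ , v₁) ∷ (v₂ , v₃) ∷ (v₄ , v₁) ∷ (v₄ , v₃) ∷ [])

-- Relabelling a 2-qBMG E along the permutation π that maps the standard 4-cycle
-- onto its underlying graph gives an orientation of that cycle, which is fixed by
-- the eight bits saying which of the two arcs is present on each of its four edges.
-- Axioms (N2) and (N3) pass to induced subgraphs, and an exhaustive search over the
-- 256 orientations shows that each one satisfying them is the image of one of the
-- ten listed digraphs under a symmetry of the square. ((N1) holds vacuously on
-- any orientation of C4: the out-neighbours of two opposite vertices are never
-- adjacent.) That the ten are pairwise non-isomorphic is a search over the injective
-- maps Fin 4 → Fin 4.
module Submission where

open import Defs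
open import Data.Fin using (Fin; _≟_)
open import Data.Fin.Patterns
open import Data.Fin.Properties using (all?; any?)
open import Data.Fin.Permutation
  using (Permutation′; _⟨$⟩ʳ_; _⟨$⟩ˡ_; inverseʳ; flip; _∘ₚ_; id; transpose)
open import Data.Nat using (zero; suc)
open import Data.Bool using (Bool; true; false; _∨_)
open import Data.Bool.Properties using (∨-conicalˡ) renaming (_≟_ to _≟ᵇ_)
open import Data.Vec using (Vec; []; _∷_; lookup; tabulate)
open import Data.Vec.Properties using (lookup∘tabulate)
open import Data.Product using (Σ; _×_; _,_; proj₁; proj₂)
open import Data.Sum using (inj₁; inj₂)
open import Function using (_∘_)
open import Function.Bundles using (Injection)
open import Function.Properties.Inverse using (↔⇒↣)
open import Relation.Nullary using (¬_; Dec; yes; no)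
open import Relation.Nullary.Decidable
  using (from-yes; decidable-stable; ¬?; _×-dec_; _⊎-dec_; _→-dec_)
open import Relation.Binary.PropositionalEquality
  using (_≡_; _≢_; refl; sym; trans; cong₂)

Induced : ∀ {m n} → Digraph m → Digraph n → (Fin m → Fin n) → Set
Induced E F f = ∀ x y → E x y ≡ F (f x) (f y)

module _ {m n o} {E : Digraph m} {F : Digraph n} {H : Digraph o} where

  induced-∘ : ∀ {f g} → Induced E F f → Induced F H g → Induced E H (g ∘ f)
  induced-∘ {f} E≗F F≗H x y = trans (E≗F x y) (F≗H (f x) (f y))

module _ {n} {E F : Digraph n} where

  induced-flip : (π : Permutation′ n) → Induced E F (π ⟨$⟩ʳ_) → Induced F E (π ⟨$⟩ˡ_)
  induced-flip π E≗F x y =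
    trans (sym (cong₂ F (inverseʳ π) (inverseʳ π))) (sym (E≗F (π ⟨$⟩ˡ x) (π ⟨$⟩ˡ y)))

module _ {m n} {E : Digraph m} {F : Digraph n} {f : Fin m → Fin n}
         (E≗F : Induced E F f) where

  edge-induced : ∀ {x y} → Edge E x y → Edge F (f x) (f y)
  edge-induced {x} {y} = trans (sym (E≗F x y))

  edge-reflected : ∀ {x y} → Edge F (f x) (f y) → Edge E x y
  edge-reflected {x} {y} = trans (E≗F x y)

  n2-induced : N2 F → N2 E
  n2-induced n2 u v w t uv vw wt =
    edge-reflected (n2 (f u) (f v) (f w) (f t)
                       (edge-induced uv) (edge-induced vw) (edge-induced wt))

  n3-induced : N3 F → N3 E
  n3-induced n3 u v (w , uw , vw) with n3 (f u) (f v) (f w , edge-induced uw , edge-induced vw)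
  ... | inj₁ u⊆v = inj₁ λ x → edge-reflected ∘ u⊆v (f x) ∘ edge-induced
  ... | inj₂ v⊆u = inj₂ λ x → edge-reflected ∘ v⊆u (f x) ∘ edge-induced

module Decide {n} (E : Digraph n) where

  edge? : ∀ x y → Dec (Edge E x y)
  edge? x y = E x y ≟ᵇ true

  properColouring? : (c : Fin n → Bool) → Dec (∀ x y → Edge E x y → c x ≢ c y)
  properColouring? c = all? λ x → all? λ y → edge? x y →-dec ¬? (c x ≟ᵇ c y)

  loopless? : Dec (Loopless E)
  loopless? = all? λ x → E x x ≟ᵇ false

  independent? : ∀ u v → Dec (Independent E u v)
  independent? u v = ¬? (u ≟ v) ×-dec ¬? (edge? u v) ×-dec ¬? (edge? v u)

  n1? : Dec (N1 E)
  n1? = all? λ u → all? λ v → independent? u v →-dec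
          ¬? (any? λ w → any? λ t → edge? u t ×-dec edge? v w ×-dec edge? t w)

  n2? : Dec (N2 E)
  n2? = all? λ u → all? λ v → all? λ w → all? λ t →
          edge? u v →-dec edge? v w →-dec edge? w t →-dec edge? u t

  n3? : Dec (N3 E)
  n3? = all? λ u → all? λ v → any? (λ w → edge? u w ×-dec edge? v w) →-dec
          (all? (λ x → edge? u x →-dec edge? v x) ⊎-dec all? (λ x → edge? v x →-dec edge? u x))

  underlying? : (U : Fin n → Fin n → Bool) → Dec (∀ x y → Underlying E x y ≡ U x y)
  underlying? U = all? λ x → all? λ y → Underlying E x y ≟ᵇ U x y

  induced? : ∀ {m} (F : Digraph m) (f : Fin n → Fin m) → Dec (Induced E F f)
  induced? F f = all? λ x → all? λ y → E x y ≟ᵇ F (f x) (f y)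

open Decide

Exhaustible : Set → Set₁
Exhaustible A = ∀ {P : A → Set} → (∀ x → Dec (P x)) → Dec (∀ x → P x)

Bool-exhaustible : Exhaustible Bool
Bool-exhaustible P? with P? true | P? false
... | yes p | yes q = yes λ { true → p ; false → q }
... | no ¬p | _     = no λ all → ¬p (all true)
... | yes _ | no ¬q = no λ all → ¬q (all false)

Vec-exhaustible : ∀ {A} → Exhaustible A → ∀ m → Exhaustible (Vec A m)
Vec-exhaustible A-exh zero    P? with P? []
... | yes p = yes λ { [] → p }
... | no ¬p = no λ all → ¬p (all [])
Vec-exhaustible A-exh (suc m) P? with A-exh (λ x → Vec-exhaustible A-exh m (P? ∘ (x ∷_)))
... | yes p = yes λ { (x ∷ xs) → p x xs }
... | no ¬p = no λ all → ¬p λ x xs → all (x ∷ xs)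

orientationC4 : Vec Bool 8 → Digraph 4
orientationC4 (a ∷ _ ∷ _ ∷ _ ∷ _ ∷ _ ∷ _ ∷ _ ∷ []) 0F 1F = a
orientationC4 (_ ∷ b ∷ _ ∷ _ ∷ _ ∷ _ ∷ _ ∷ _ ∷ []) 1F 0F = b
orientationC4 (_ ∷ _ ∷ c ∷ _ ∷ _ ∷ _ ∷ _ ∷ _ ∷ []) 1F 2F = c
orientationC4 (_ ∷ _ ∷ _ ∷ d ∷ _ ∷ _ ∷ _ ∷ _ ∷ []) 2F 1F = d
orientationC4 (_ ∷ _ ∷ _ ∷ _ ∷ e ∷ _ ∷ _ ∷ _ ∷ []) 2F 3F = e
orientationC4 (_ ∷ _ ∷ _ ∷ _ ∷ _ ∷ f ∷ _ ∷ _ ∷ []) 3F 2F = f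
orientationC4 (_ ∷ _ ∷ _ ∷ _ ∷ _ ∷ _ ∷ g ∷ _ ∷ []) 3F 0F = g
orientationC4 (_ ∷ _ ∷ _ ∷ _ ∷ _ ∷ _ ∷ _ ∷ h ∷ []) 0F 3F = h
orientationC4 _                                     _  _  = false

arcsC4 : Digraph 4 → Vec Bool 8
arcsC4 E = E 0F 1F ∷ E 1F 0F ∷ E 1F 2F ∷ E 2F 1F ∷ E 2F 3F ∷ E 3F 2F ∷ E 3F 0F ∷ E 0F 3F ∷ []

orientationC4-arcsC4 : ∀ E → (∀ x y → Underlying E x y ≡ C4 x y) →
                       ∀ x y → orientationC4 (arcsC4 E) x y ≡ E x y
orientationC4-arcsC4 E _ 0F 1F = refl
orientationC4-arcsC4 E _ 1F 0F = refl
orientationC4-arcsC4 E _ 1F 2F = refl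
orientationC4-arcsC4 E _ 2F 1F = refl
orientationC4-arcsC4 E _ 2F 3F = refl
orientationC4-arcsC4 E _ 3F 2F = refl
orientationC4-arcsC4 E _ 3F 0F = refl
orientationC4-arcsC4 E _ 0F 3F = refl
orientationC4-arcsC4 E U 0F 0F = sym (∨-conicalˡ _ _ (U 0F 0F))
orientationC4-arcsC4 E U 0F 2F = sym (∨-conicalˡ _ _ (U 0F 2F))
orientationC4-arcsC4 E U 1F 1F = sym (∨-conicalˡ _ _ (U 1F 1F))
orientationC4-arcsC4 E U 1F 3F = sym (∨-conicalˡ _ _ (U 1F 3F))
orientationC4-arcsC4 E U 2F 0F = sym (∨-conicalˡ _ _ (U 2F 0F))
orientationC4-arcsC4 E U 2F 2F = sym (∨-conicalˡ _ _ (U 2F 2F))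
orientationC4-arcsC4 E U 3F 1F = sym (∨-conicalˡ _ _ (U 3F 1F))
orientationC4-arcsC4 E U 3F 3F = sym (∨-conicalˡ _ _ (U 3F 3F))

rotation reflection : Permutation′ 4
rotation   = transpose 0F 1F ∘ₚ transpose 1F 2F ∘ₚ transpose 2F 3F
reflection = transpose 1F 3F

-- An isomorphism between two orientations of C4 is an automorphism of C4,
-- so these eight symmetries of the square are the only relabellings needed.
dihedral : Fin 8 → Permutation′ 4
dihedral 0F = id
dihedral 1F = rotation
dihedral 2F = rotation ∘ₚ rotation
dihedral 3F = rotation ∘ₚ rotation ∘ₚ rotation
dihedral 4F = reflection
dihedral 5F = reflection ∘ₚ rotation
dihedral 6F = reflection ∘ₚ rotation ∘ₚ rotation
dihedral 7F = reflection ∘ₚ rotation ∘ₚ rotation ∘ₚ rotation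

DihedralToG : Digraph 4 → Set
DihedralToG D = Σ (Fin 10) λ i → Σ (Fin 8) λ k → Induced D (G i) (dihedral k ⟨$⟩ʳ_)

parity : Fin 4 → Bool
parity 0F = true
parity 1F = false
parity 2F = true
parity 3F = false

-- The searches are abstract so that their uses do not unfold them and rerun them.
abstract
  G-satisfies-axioms : ∀ i →
    (∀ x y → Edge (G i) x y → parity x ≢ parity y) × Loopless (G i) ×
    N1 (G i) × N2 (G i) × N3 (G i) × (∀ x y → Underlying (G i) x y ≡ C4 x y)
  G-satisfies-axioms = from-yes
    (all? λ i → properColouring? (G i) parity ×-dec loopless? (G i) ×-dec
       n1? (G i) ×-dec n2? (G i) ×-dec n3? (G i) ×-dec underlying? (G i) C4)

  orientationC4-dihedralToG : ∀ v → let D = orientationC4 v in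
    (∀ x y → Underlying D x y ≡ C4 x y) → N2 D → N3 D → DihedralToG D
  orientationC4-dihedralToG = from-yes
    (Vec-exhaustible Bool-exhaustible 8 λ v → let D = orientationC4 v in
       underlying? D C4 →-dec n2? D →-dec n3? D →-dec
       any? λ i → any? λ k → induced? D (G i) (dihedral k ⟨$⟩ʳ_))

  G-no-injective-relabelling : ∀ i j → i ≢ j → ∀ (v : Vec (Fin 4) 4) →
    (∀ x y → lookup v x ≡ lookup v y → x ≡ y) → ¬ Induced (G i) (G j) (lookup v)
  G-no-injective-relabelling = from-yes
    (all? λ i → all? λ j → ¬? (i ≟ j) →-dec
       Vec-exhaustible all? 4 λ v →
         (all? λ x → all? λ y → lookup v x ≟ lookup v y →-dec x ≟ y) →-dec
         ¬? (induced? (G i) (G j) (lookup v)))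

G-is2qBMG-C4 : (i : Fin 10) → Is2qBMG (G i) × UnderlyingIsC4 (G i)
G-is2qBMG-C4 i with G-satisfies-axioms i
... | proper , loopless , n1 , n2 , n3 , underlying =
  ((parity , proper) , loopless , n1 , n2 , n3) , (id , underlying)

is2qBMG-C4-isomorphic-to-G : (E : Digraph 4) → Is2qBMG E → UnderlyingIsC4 E →
                             Σ (Fin 10) λ i → Isomorphic E (G i)
is2qBMG-C4-isomorphic-to-G E (_ , _ , _ , n2 , n3) (π , underlying) =
  i , flip π ∘ₚ dihedral k , E≗Gᵢ
  where
  E′ : Digraph 4
  E′ x y = E (π ⟨$⟩ʳ x) (π ⟨$⟩ʳ y)

  D≗E : Induced (orientationC4 (arcsC4 E′)) E (π ⟨$⟩ʳ_)
  D≗E = orientationC4-arcsC4 E′ underlying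

  classified : DihedralToG (orientationC4 (arcsC4 E′))
  classified = orientationC4-dihedralToG (arcsC4 E′)
    (λ x y → trans (cong₂ _∨_ (D≗E x y) (D≗E y x)) (underlying x y))
    (n2-induced D≗E n2) (n3-induced D≗E n3)

  i = proj₁ classified
  k = proj₁ (proj₂ classified)

  E≗Gᵢ : Induced E (G i) ((flip π ∘ₚ dihedral k) ⟨$⟩ʳ_)
  E≗Gᵢ = induced-∘ {H = G i} {g = dihedral k ⟨$⟩ʳ_}
                   (induced-flip π D≗E) (proj₂ (proj₂ classified))

G-pairwise-nonisomorphic : (i j : Fin 10) → Isomorphic (G i) (G j) → i ≡ j
G-pairwise-nonisomorphic i j (φ , Gᵢ≗Gⱼ) = decidable-stable (i ≟ j) λ i≢j →
  G-no-injective-relabelling i j i≢j (tabulate (φ ⟨$⟩ʳ_)) injective Gᵢ≗Gⱼ′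
  where
  lookup-φ : ∀ x → lookup (tabulate (φ ⟨$⟩ʳ_)) x ≡ φ ⟨$⟩ʳ x
  lookup-φ = lookup∘tabulate (φ ⟨$⟩ʳ_)

  injective : ∀ x y → lookup (tabulate (φ ⟨$⟩ʳ_)) x ≡ lookup (tabulate (φ ⟨$⟩ʳ_)) y → x ≡ y
  injective x y eq =
    Injection.injective (↔⇒↣ φ) (trans (sym (lookup-φ x)) (trans eq (lookup-φ y)))

  Gᵢ≗Gⱼ′ : Induced (G i) (G j) (lookup (tabulate (φ ⟨$⟩ʳ_)))
  Gᵢ≗Gⱼ′ x y = trans (Gᵢ≗Gⱼ x y) (sym (cong₂ (G j) (lookup-φ x) (lookup-φ y)))

theorem3p11 : ((i : Fin 10) → Is2qBMG (G i) × UnderlyingIsC4 (G i))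
    × ((E : Digraph 4) → Is2qBMG E → UnderlyingIsC4 E → Σ (Fin 10) λ i → Isomorphic E (G i))
    × ((i j : Fin 10) → Isomorphic (G i) (G j) → i ≡ j)
theorem3p11 = G-is2qBMG-C4 , is2qBMG-C4-isomorphic-to-G , G-pairwise-nonisomorphic
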